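{- For an integer $k\ge3$, $$\sum_{j=2}^{k-1}\zeta(j,k-j)=\zeta(k),\qquad \sum_{j=2}^{k-1}\zeta^{(2)}(j,\overline{k-j})=\zeta^{(2)}(\overline{k-1},1)-\zeta^{(2)}(\overline{k-1},\overline{1})+\zeta^{(2)}(\overline{k}),$$ $$\sum_{j=1}^{k-1}\zeta^{(2)}(\overline{j},\overline{k-j})=\zeta^{(2)}(\overline{1},k-1)+\zeta^{(2)}(\overline{k}),$$ $$\sum_{j=1}^{k-1}\zeta^{(2)}(\overline{j},k-j)=\zeta^{(2)}(\overline{k-1},\overline{1})-\zeta^{(2)}(\overline{k-1},1)+\zeta^{(2)}(\overline{1},\overline{k-1})+\zeta(k).$$
   Context: $\zeta(k_1,\ldots,k_n)=\sum_{m_1>\cdots>m_n>0}1/(m_1^{k_1}\cdots m_n^{k_n})$ are multiple zeta values. Alternating multiple zeta values: for positive integers $k_i$ and $a_i\in\{0,1\}$, $\zeta^{(2)}(\boxed{k_1},\ldots,\boxed{k_n})=\sum_{m_1>\cdots>m_n>0}(-1)^{a_1m_1+\cdots+a_nm_n}/(m_1^{k_1}\cdots m_n^{k_n})$, where $\boxed{k_i}$ is written $k_i$ if $a_i=0$ and $\overline{k_i}$ if $a_i=1$ (convergent when $k_1\ge2$ or $a_1=1$). -}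

module Defs where

open import Data.Bool using (Bool; true; false)
open import Data.Nat as ℕ using (ℕ; zero; suc; _^_; _≤_)
open import Data.Nat.Properties using (m^n≢0)
open import Data.Integer using (+_)
open import Data.Rational using (ℚ; 0ℚ; 1ℚ; _/_; _+_; _-_; _*_; -_; ∣_∣; _<_)
open import Data.Product using (∃)

negOnePow : ℕ → ℚ
negOnePow zero    = 1ℚ
negOnePow (suc m) = - negOnePow m

-- sign (-1)^(a m) for a ∈ {0,1} (false = 0, i.e. unbarred; true = 1, i.e. barred)
sgn : Bool → ℕ → ℚ
sgn false m = 1ℚ
sgn true  m = negOnePow m

-- the summand (-1)^(a m) / m^k  evaluated at m = suc n  (so m ≥ 1)
term : ℕ → Bool → ℕ → ℚ
term k a n = sgn a (suc n) * ((+ 1) / (suc n ^ k)) {{m^n≢0 (suc n) k}}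

Z1 : ℕ → Bool → ℕ → ℚ
Z1 k a zero    = 0ℚ
Z1 k a (suc N) = Z1 k a N + term k a N

-- depth-2 partial sum (truncated in the outer index):
--   Σ_{N ≥ m₁ > m₂ > 0} (-1)^(a₁ m₁ + a₂ m₂) / (m₁^k₁ m₂^k₂)
Z2 : ℕ → Bool → ℕ → Bool → ℕ → ℚ
Z2 k₁ a₁ k₂ a₂ zero    = 0ℚ
Z2 k₁ a₁ k₂ a₂ (suc N) = Z2 k₁ a₁ k₂ a₂ N + term k₁ a₁ N * Z1 k₂ a₂ N

-- finite sum  Σ_{j = lo}^{lo + n - 1} f j
sumFrom : ℕ → ℕ → (ℕ → ℚ) → ℚ
sumFrom lo zero    f = 0ℚ
sumFrom lo (suc n) f = sumFrom lo n f + f (lo ℕ.+ n)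

SameLimit : (ℕ → ℚ) → (ℕ → ℚ) → Set
SameLimit s t = ∀ (ε : ℚ) → 0ℚ < ε → ∃ λ N₀ → ∀ N → N₀ ≤ N → ∣ s N - t N ∣ < ε

-- For signs a, b and weight k = K + 1 write the j-th depth-two partial sum as
-- Σ_{N ≥ m > n > 0} ε_m δ_n / (m^j n^(k-j)). Summed over j the inner sum is a finite geometric
-- series, which the partial fraction 1/(mn) = (1/(m-n))(1/n - 1/m) telescopes to
-- (1/(m-n))(1/n^K - 1/m^K). Reflecting n ↦ m - n turns the 1/m^K half into the (K, 1) double sum.
-- Substituting m = n + d in the 1/n^K half gives Σ_n (sign)/n^K · h(N - n), with h the partial sums
-- of ±1/d, and h(N - n) = (h(N - n) - h(N)) + (h(N) - h(n)) + h(n) splits it into an error term,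
-- the (1, K) double sum, and a (K, 1) double sum plus its diagonal m = n, the depth-one value of
-- weight k. As |h(N) - h(N - n)| ≤ n/(N - n + 1) and K ≥ 2, the error is at most
-- (2/(N + 1)) Σ_{n ≤ N} 1/n, which tends to 0. The four identities are the sign patterns; when
-- a = 0 the j = 1 term appears on both sides and cancels.

module Submission where

open import Defs
open import Data.Bool using (Bool; true; false; _xor_)
open import Data.Nat as ℕ using (ℕ; zero; suc; _≤_; _∸_; z≤n; s≤s)
import Data.Nat.Properties as ℕP
import Data.Nat.Tactic.RingSolver as ℕR
open import Data.Integer as ℤ using (+_)
import Data.Integer.Properties as ℤP
open import Data.Rational
  using (ℚ; mkℚ; 0ℚ; 1ℚ; ½; _/_; _+_; _-_; _*_; -_; ∣_∣; _<_; fromℚᵘ; positive; nonNegative; *<*)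
  renaming (_≤_ to _≤ℚ_)
open import Data.Rational.Properties
open import Data.Rational.Unnormalised as ℚᵘ using (mkℚᵘ)
import Data.Rational.Unnormalised.Properties as ℚᵘP
open import Function using (_∘_)
open import Level using (0ℓ)
open import Data.Product using (_×_; _,_; ∃; proj₁; proj₂)
open import Relation.Binary.PropositionalEquality
open import Relation.Nullary using (yes; no)
open import Relation.Nullary.Decidable.Core using (dec⇒maybe)
open import Tactic.RingSolver using (solve-∀)
open import Tactic.RingSolver.Core.AlmostCommutativeRing using (AlmostCommutativeRing; fromCommutativeRing)

-- Rational arithmetic

ℚ-ring : AlmostCommutativeRing 0ℓ 0ℓ
ℚ-ring = fromCommutativeRing +-*-commutativeRing (λ x → dec⇒maybe (0ℚ ≟ x))

fromℚᵘ-homo-* : ∀ p q → fromℚᵘ (p ℚᵘ.* q) ≡ fromℚᵘ p * fromℚᵘ q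
fromℚᵘ-homo-* p q = toℚᵘ-injective (ℚᵘP.≃-trans (toℚᵘ-fromℚᵘ (p ℚᵘ.* q))
  (ℚᵘP.≃-sym (ℚᵘP.≃-trans (toℚᵘ-homo-* (fromℚᵘ p) (fromℚᵘ q))
    (ℚᵘP.*-cong (toℚᵘ-fromℚᵘ p) (toℚᵘ-fromℚᵘ q)))))

fromℚᵘ-homo-+ : ∀ p q → fromℚᵘ (p ℚᵘ.+ q) ≡ fromℚᵘ p + fromℚᵘ q
fromℚᵘ-homo-+ p q = toℚᵘ-injective (ℚᵘP.≃-trans (toℚᵘ-fromℚᵘ (p ℚᵘ.+ q))
  (ℚᵘP.≃-sym (ℚᵘP.≃-trans (toℚᵘ-homo-+ (fromℚᵘ p) (fromℚᵘ q))
    (ℚᵘP.+-cong (toℚᵘ-fromℚᵘ p) (toℚᵘ-fromℚᵘ q)))))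

fromℚᵘ-mono-≤ : ∀ {p q} → p ℚᵘ.≤ q → fromℚᵘ p ≤ℚ fromℚᵘ q
fromℚᵘ-mono-≤ {p} {q} p≤q = toℚᵘ-cancel-≤ (ℚᵘP.≤-respˡ-≃ (ℚᵘP.≃-sym (toℚᵘ-fromℚᵘ p))
  (ℚᵘP.≤-respʳ-≃ (ℚᵘP.≃-sym (toℚᵘ-fromℚᵘ q)) p≤q))

fromℚᵘ-mono-< : ∀ {p q} → p ℚᵘ.< q → fromℚᵘ p < fromℚᵘ q
fromℚᵘ-mono-< {p} {q} p<q = toℚᵘ-cancel-< (ℚᵘP.<-respˡ-≃ (ℚᵘP.≃-sym (toℚᵘ-fromℚᵘ p))
  (ℚᵘP.<-respʳ-≃ (ℚᵘP.≃-sym (toℚᵘ-fromℚᵘ q)) p<q))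

+/-cong : ∀ {a b c d} → a ℕ.* suc d ≡ c ℕ.* suc b → + a / suc b ≡ + c / suc d
+/-cong {a} {b} {c} {d} eq = fromℚᵘ-cong {mkℚᵘ (+ a) b} {mkℚᵘ (+ c) d} (ℚᵘ.*≡* (begin
  + a ℤ.* + suc d   ≡⟨ ℤP.pos-* a (suc d) ⟨
  + (a ℕ.* suc d)   ≡⟨ cong +_ eq ⟩
  + (c ℕ.* suc b)   ≡⟨ ℤP.pos-* c (suc b) ⟩
  + c ℤ.* + suc b   ∎))
  where open ≡-Reasoning

+/-mono-≤ : ∀ {a b c d} → a ℕ.* suc d ℕ.≤ c ℕ.* suc b → + a / suc b ≤ℚ + c / suc d
+/-mono-≤ {a} {b} {c} {d} le = fromℚᵘ-mono-≤ {mkℚᵘ (+ a) b} {mkℚᵘ (+ c) d} (ℚᵘ.*≤*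
  (subst₂ ℤ._≤_ (ℤP.pos-* a (suc d)) (ℤP.pos-* c (suc b)) (ℤ.+≤+ le)))

+/-mono-< : ∀ {a b c d} → a ℕ.* suc d ℕ.< c ℕ.* suc b → + a / suc b < + c / suc d
+/-mono-< {a} {b} {c} {d} lt = fromℚᵘ-mono-< {mkℚᵘ (+ a) b} {mkℚᵘ (+ c) d} (ℚᵘ.*<*
  (subst₂ ℤ._<_ (ℤP.pos-* a (suc d)) (ℤP.pos-* c (suc b)) (ℤ.+<+ lt)))

fromℕ : ℕ → ℚ
fromℕ n = + n / 1

1/[1+_] : ℕ → ℚ
1/[1+ n ] = + 1 / suc n

infixr 8 _^_
_^_ : ℚ → ℕ → ℚ
x ^ zero  = 1ℚ
x ^ suc k = x * x ^ k

fromℕ-+ : ∀ m n → fromℕ (m ℕ.+ n) ≡ fromℕ m + fromℕ n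
fromℕ-+ m n = trans
  (fromℚᵘ-cong {mkℚᵘ (+ (m ℕ.+ n)) 0} {mkℚᵘ (+ m) 0 ℚᵘ.+ mkℚᵘ (+ n) 0} (ℚᵘ.*≡* (cong (ℤ._* + 1)
    (trans (ℤP.pos-+ m n) (sym (cong₂ ℤ._+_ (ℤP.*-identityʳ (+ m)) (ℤP.*-identityʳ (+ n))))))))
  (fromℚᵘ-homo-+ (mkℚᵘ (+ m) 0) (mkℚᵘ (+ n) 0))

fromℕ-suc : ∀ n → fromℕ (suc n) ≡ 1ℚ + fromℕ n
fromℕ-suc = fromℕ-+ 1

fromℕ-[1+m]+[1+n] : ∀ m n → fromℕ (suc (suc (m ℕ.+ n))) ≡ fromℕ (suc m) + fromℕ (suc n)
fromℕ-[1+m]+[1+n] m n = trans (cong (fromℕ ∘ suc) (sym (ℕP.+-suc m n))) (fromℕ-+ (suc m) (suc n))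

fromℕ*1/[1+n]≡1 : ∀ n → fromℕ (suc n) * 1/[1+ n ] ≡ 1ℚ
fromℕ*1/[1+n]≡1 n = trans (sym (fromℚᵘ-homo-* (mkℚᵘ (+ suc n) 0) (mkℚᵘ (+ 1) n)))
  (+/-cong {suc n ℕ.* 1} {n ℕ.+ 0} {1} {0} (cross n))
  where
  cross : ∀ n → suc n ℕ.* 1 ℕ.* 1 ≡ 1 ℕ.* suc (n ℕ.+ 0)
  cross = ℕR.solve-∀

1/m*1/n≡1/[m*n] : ∀ m n .{{_ : ℕ.NonZero m}} .{{_ : ℕ.NonZero n}} →
                  (+ 1 / m) * (+ 1 / n) ≡ (+ 1 / (m ℕ.* n)) {{ℕP.m*n≢0 m n}}
1/m*1/n≡1/[m*n] (suc m) (suc n) = sym (fromℚᵘ-homo-* (mkℚᵘ (+ 1) m) (mkℚᵘ (+ 1) n))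

1/m^k≡[1/m]^k : ∀ n k → (+ 1 / (suc n ℕ.^ k)) {{ℕP.m^n≢0 (suc n) k}} ≡ 1/[1+ n ] ^ k
1/m^k≡[1/m]^k n zero    = refl
1/m^k≡[1/m]^k n (suc k) = trans
  (sym (1/m*1/n≡1/[m*n] (suc n) (suc n ℕ.^ k) {{_}} {{ℕP.m^n≢0 (suc n) k}}))
  (cong (1/[1+ n ] *_) (1/m^k≡[1/m]^k n k))

fromℕ-mono-≤ : ∀ {m n} → m ≤ n → fromℕ m ≤ℚ fromℕ n
fromℕ-mono-≤ {m} {n} m≤n = +/-mono-≤ {m} {0} {n} {0} (ℕP.*-monoˡ-≤ 1 m≤n)

fromℕ-nonNeg : ∀ n → 0ℚ ≤ℚ fromℕ n
fromℕ-nonNeg n = fromℕ-mono-≤ {0} {n} z≤n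

fromℕ-pos : ∀ n → 0ℚ < fromℕ (suc n)
fromℕ-pos n = +/-mono-< {0} {0} {suc n} {0} (s≤s z≤n)

1/[1+]-antitone : ∀ {m n} → m ≤ n → 1/[1+ n ] ≤ℚ 1/[1+ m ]
1/[1+]-antitone {m} {n} m≤n = +/-mono-≤ {1} {n} {1} {m} (ℕP.*-monoʳ-≤ 1 (s≤s m≤n))

1/[1+]-pos : ∀ n → 0ℚ < 1/[1+ n ]
1/[1+]-pos n = +/-mono-< {0} {0} {1} {n} (s≤s z≤n)

1/[1+]-nonNeg : ∀ n → 0ℚ ≤ℚ 1/[1+ n ]
1/[1+]-nonNeg n = <⇒≤ (1/[1+]-pos n)

1/[1+]≤1 : ∀ n → 1/[1+ n ] ≤ℚ 1ℚ
1/[1+]≤1 n = 1/[1+]-antitone {0} {n} z≤n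

archimedean : ∀ ε → 0ℚ < ε → ∃ λ n → 1/[1+ n ] < ε
archimedean (mkℚ (+ zero) _ _)  (*<* (ℤ.+<+ ()))
archimedean (mkℚ ℤ.-[1+ _ ] _ _) (*<* ())
archimedean (mkℚ (+ suc p) d _) _ = suc d , toℚᵘ-cancel-<
  (ℚᵘP.<-respˡ-≃ (ℚᵘP.≃-sym (toℚᵘ-fromℚᵘ (mkℚᵘ (+ 1) (suc d)))) (ℚᵘ.*<* (subst₂ ℤ._<_
    (sym (ℤP.*-identityˡ (+ suc d))) (ℤP.pos-* (suc p) (suc (suc d)))
    (ℤ.+<+ (ℕP.<-≤-trans (ℕP.n<1+n (suc d)) (ℕP.m≤n*m (suc (suc d)) (suc p)))))))

reciprocals-difference : ∀ {A B D X Y} → A * X ≡ 1ℚ → B * Y ≡ 1ℚ → A ≡ B + D → D * X * Y ≡ Y - X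
reciprocals-difference {A} {B} {D} {X} {Y} AX≡1 BY≡1 refl = begin
  D * X * Y                      ≡⟨ expand B D X Y ⟩
  (B + D) * X * Y - (B * Y) * X  ≡⟨ cong₂ (λ p q → p * Y - q * X) AX≡1 BY≡1 ⟩
  1ℚ * Y - 1ℚ * X                ≡⟨ cong₂ _-_ (*-identityˡ Y) (*-identityˡ X) ⟩
  Y - X                          ∎
  where
  open ≡-Reasoning
  expand : ∀ B D X Y → D * X * Y ≡ (B + D) * X * Y - (B * Y) * X
  expand = solve-∀ ℚ-ring

reciprocals-product : ∀ {A B X Y Z} → A * X ≡ 1ℚ → B * Y ≡ 1ℚ → (A + B) * Z ≡ 1ℚ →
                      X * Y ≡ Z * (X + Y)
reciprocals-product {A} {B} {X} {Y} {Z} AX≡1 BY≡1 [A+B]Z≡1 = begin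
  X * Y                                ≡⟨ *-identityˡ (X * Y) ⟨
  1ℚ * (X * Y)                         ≡⟨ cong (_* (X * Y)) [A+B]Z≡1 ⟨
  (A + B) * Z * (X * Y)                ≡⟨ expand A B X Y Z ⟩
  Z * ((A * X) * Y + (B * Y) * X)      ≡⟨ cong₂ (λ p q → Z * (p * Y + q * X)) AX≡1 BY≡1 ⟩
  Z * (1ℚ * Y + 1ℚ * X)                ≡⟨ cong (Z *_) (cong₂ _+_ (*-identityˡ Y) (*-identityˡ X)) ⟩
  Z * (Y + X)                          ≡⟨ cong (Z *_) (+-comm Y X) ⟩
  Z * (X + Y)                          ∎
  where
  open ≡-Reasoning
  expand : ∀ A B X Y Z → (A + B) * Z * (X * Y) ≡ Z * ((A * X) * Y + (B * Y) * X)
  expand = solve-∀ ℚ-ring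

1/[1+]-difference : ∀ n d →
  fromℕ (suc d) * 1/[1+ suc (n ℕ.+ d) ] * 1/[1+ n ] ≡ 1/[1+ n ] - 1/[1+ suc (n ℕ.+ d) ]
1/[1+]-difference n d = reciprocals-difference {B = fromℕ (suc n)} {D = fromℕ (suc d)}
  (fromℕ*1/[1+n]≡1 (suc (n ℕ.+ d))) (fromℕ*1/[1+n]≡1 n) (fromℕ-[1+m]+[1+n] n d)

1/[1+]-product : ∀ m n → 1/[1+ m ] * 1/[1+ n ] ≡ 1/[1+ suc (m ℕ.+ n) ] * (1/[1+ m ] + 1/[1+ n ])
1/[1+]-product m n = reciprocals-product {A = fromℕ (suc m)} {B = fromℕ (suc n)}
  (fromℕ*1/[1+n]≡1 m) (fromℕ*1/[1+n]≡1 n)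
  (subst (λ A → A * 1/[1+ suc (m ℕ.+ n) ] ≡ 1ℚ) (fromℕ-[1+m]+[1+n] m n) (fromℕ*1/[1+n]≡1 (suc (m ℕ.+ n))))

*-nonNeg : ∀ {p q} → 0ℚ ≤ℚ p → 0ℚ ≤ℚ q → 0ℚ ≤ℚ p * q
*-nonNeg {p} {q} 0≤p 0≤q =
  nonNegative⁻¹ (p * q) {{nonNeg*nonNeg⇒nonNeg p {{nonNegative 0≤p}} q {{nonNegative 0≤q}}}}

*-mono-≤-nonNeg : ∀ {p q r s} → 0ℚ ≤ℚ p → 0ℚ ≤ℚ r → p ≤ℚ q → r ≤ℚ s → p * r ≤ℚ q * s
*-mono-≤-nonNeg {p} {q} {r} {s} 0≤p 0≤r p≤q r≤s = ≤-trans
  (*-monoʳ-≤-nonNeg r {{nonNegative 0≤r}} p≤q)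
  (*-monoˡ-≤-nonNeg q {{nonNegative (≤-trans 0≤p p≤q)}} r≤s)

^-nonNeg : ∀ {x} k → 0ℚ ≤ℚ x → 0ℚ ≤ℚ x ^ k
^-nonNeg zero    0≤x = 1/[1+]-nonNeg 0
^-nonNeg (suc k) 0≤x = *-nonNeg 0≤x (^-nonNeg k 0≤x)

^-antitone : ∀ {x m n} → 0ℚ ≤ℚ x → x ≤ℚ 1ℚ → m ≤ n → x ^ n ≤ℚ x ^ m
^-antitone {x} {n = n} 0≤x x≤1 z≤n = ≤ℚ1 n
  where
  ≤ℚ1 : ∀ n → x ^ n ≤ℚ 1ℚ
  ≤ℚ1 zero    = ≤-refl
  ≤ℚ1 (suc n) = ≤-trans (*-monoˡ-≤-nonNeg x {{nonNegative 0≤x}} (≤ℚ1 n))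
                        (≤-trans (≤-reflexive (*-identityʳ x)) x≤1)
^-antitone {x} 0≤x x≤1 (s≤s m≤n) = *-monoˡ-≤-nonNeg x {{nonNegative 0≤x}} (^-antitone 0≤x x≤1 m≤n)

-- Signs and summands

negOnePow-+ : ∀ m n → negOnePow (m ℕ.+ n) ≡ negOnePow m * negOnePow n
negOnePow-+ zero    n = sym (*-identityˡ (negOnePow n))
negOnePow-+ (suc m) n = trans (cong -_ (negOnePow-+ m n)) (neg-distribˡ-* (negOnePow m) (negOnePow n))

negOnePow-square : ∀ n → negOnePow n * negOnePow n ≡ 1ℚ
negOnePow-square zero    = refl
negOnePow-square (suc n) = trans (neg*neg (negOnePow n)) (negOnePow-square n)
  where
  neg*neg : ∀ x → (- x) * (- x) ≡ x * x
  neg*neg = solve-∀ ℚ-ring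

sgn-+ : ∀ a m n → sgn a (m ℕ.+ n) ≡ sgn a m * sgn a n
sgn-+ false m n = refl
sgn-+ true  m n = negOnePow-+ m n

sgn-square : ∀ a n → sgn a n * sgn a n ≡ 1ℚ
sgn-square false n = refl
sgn-square true  n = negOnePow-square n

sgn-∸ : ∀ a {m n} → n ≤ m → sgn a (m ∸ n) ≡ sgn a m * sgn a n
sgn-∸ a {m} {n} n≤m = begin
  sgn a (m ∸ n)                              ≡⟨ *-identityʳ _ ⟨
  sgn a (m ∸ n) * 1ℚ                         ≡⟨ cong (sgn a (m ∸ n) *_) (sgn-square a n) ⟨
  sgn a (m ∸ n) * (sgn a n * sgn a n)        ≡⟨ *-assoc (sgn a (m ∸ n)) (sgn a n) (sgn a n) ⟨
  sgn a (m ∸ n) * sgn a n * sgn a n          ≡⟨ cong (_* sgn a n) (sgn-+ a (m ∸ n) n) ⟨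
  sgn a (m ∸ n ℕ.+ n) * sgn a n              ≡⟨ cong (λ k → sgn a k * sgn a n) (ℕP.m∸n+n≡m n≤m) ⟩
  sgn a m * sgn a n                          ∎
  where open ≡-Reasoning

sgn-xor : ∀ a b n → sgn (a xor b) n ≡ sgn a n * sgn b n
sgn-xor false b     n = sym (*-identityˡ (sgn b n))
sgn-xor true  false n = sym (*-identityʳ (negOnePow n))
sgn-xor true  true  n = sym (negOnePow-square n)

∣sgn∣≡1 : ∀ a n → ∣ sgn a n ∣ ≡ 1ℚ
∣sgn∣≡1 false n       = refl
∣sgn∣≡1 true  zero    = refl
∣sgn∣≡1 true  (suc n) = trans (∣-p∣≡∣p∣ (negOnePow n)) (∣sgn∣≡1 true n)

term-≡ : ∀ k a n → term k a n ≡ sgn a (suc n) * 1/[1+ n ] ^ k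
term-≡ k a n = cong (sgn a (suc n) *_) (1/m^k≡[1/m]^k n k)

term-xor : ∀ k a b n → term k (a xor b) n ≡ (sgn a (suc n) * sgn b (suc n)) * 1/[1+ n ] ^ k
term-xor k a b n = trans (term-≡ k (a xor b) n) (cong (_* 1/[1+ n ] ^ k) (sgn-xor a b (suc n)))

∣term∣ : ∀ k a n → ∣ term k a n ∣ ≡ 1/[1+ n ] ^ k
∣term∣ k a n = begin
  ∣ term k a n ∣                               ≡⟨ cong ∣_∣ (term-≡ k a n) ⟩
  ∣ sgn a (suc n) * 1/[1+ n ] ^ k ∣            ≡⟨ ∣p*q∣≡∣p∣*∣q∣ (sgn a (suc n)) (1/[1+ n ] ^ k) ⟩
  ∣ sgn a (suc n) ∣ * ∣ 1/[1+ n ] ^ k ∣        ≡⟨ cong₂ _*_ (∣sgn∣≡1 a (suc n))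
                                                             (0≤p⇒∣p∣≡p (^-nonNeg k (1/[1+]-nonNeg n))) ⟩
  1ℚ * 1/[1+ n ] ^ k                           ≡⟨ *-identityˡ _ ⟩
  1/[1+ n ] ^ k                                ∎
  where open ≡-Reasoning
term-xor*term₁ : ∀ K a b n → term K (a xor b) n * term 1 a n ≡ term (suc K) b n
term-xor*term₁ K a b n = begin
  term K (a xor b) n * term 1 a n                       ≡⟨ cong₂ _*_ (term-xor K a b n) (term-≡ 1 a n) ⟩
  (σ * τ) * Y ^ K * (σ * (Y * 1ℚ))                      ≡⟨ regroup σ τ Y (Y ^ K) ⟩
  (σ * σ) * (τ * (Y * Y ^ K))                           ≡⟨ cong (_* (τ * (Y * Y ^ K))) (sgn-square a (suc n)) ⟩
  1ℚ * (τ * (Y * Y ^ K))                                ≡⟨ *-identityˡ _ ⟩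
  τ * Y ^ suc K                                         ≡⟨ term-≡ (suc K) b n ⟨
  term (suc K) b n                                      ∎
  where
  open ≡-Reasoning
  σ τ Y : ℚ
  σ = sgn a (suc n)
  τ = sgn b (suc n)
  Y = 1/[1+ n ]
  regroup : ∀ σ τ Y P → (σ * τ) * P * (σ * (Y * 1ℚ)) ≡ (σ * σ) * (τ * (Y * P))
  regroup = solve-∀ ℚ-ring

-- Finite sums

∑ : ℕ → (ℕ → ℚ) → ℚ
∑ = sumFrom 0

∑-cong-< : ∀ n {f g : ℕ → ℚ} → (∀ i → i ℕ.< n → f i ≡ g i) → ∑ n f ≡ ∑ n g
∑-cong-< zero    f≡g = refl
∑-cong-< (suc n) f≡g =
  cong₂ _+_ (∑-cong-< n (λ i i<n → f≡g i (ℕP.m<n⇒m<1+n i<n))) (f≡g n ℕP.≤-refl)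

∑-cong : ∀ n {f g : ℕ → ℚ} → (∀ i → f i ≡ g i) → ∑ n f ≡ ∑ n g
∑-cong n f≡g = ∑-cong-< n (λ i _ → f≡g i)

∑-zero : ∀ n → ∑ n (λ _ → 0ℚ) ≡ 0ℚ
∑-zero zero    = refl
∑-zero (suc n) = trans (+-identityʳ _) (∑-zero n)

∑-distrib-+ : ∀ n (f g : ℕ → ℚ) → ∑ n (λ i → f i + g i) ≡ ∑ n f + ∑ n g
∑-distrib-+ zero    f g = refl
∑-distrib-+ (suc n) f g =
  trans (cong (_+ (f n + g n)) (∑-distrib-+ n f g)) (middle-swap (∑ n f) (∑ n g) (f n) (g n))
  where
  middle-swap : ∀ a b c d → (a + b) + (c + d) ≡ (a + c) + (b + d)
  middle-swap = solve-∀ ℚ-ring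

∑-distrib-- : ∀ n (f g : ℕ → ℚ) → ∑ n (λ i → f i - g i) ≡ ∑ n f - ∑ n g
∑-distrib-- zero    f g = refl
∑-distrib-- (suc n) f g =
  trans (cong (_+ (f n - g n)) (∑-distrib-- n f g)) (middle-swap (∑ n f) (∑ n g) (f n) (g n))
  where
  middle-swap : ∀ a b c d → (a - b) + (c - d) ≡ (a + c) - (b + d)
  middle-swap = solve-∀ ℚ-ring

∑-distribˡ-* : ∀ n c (f : ℕ → ℚ) → c * ∑ n f ≡ ∑ n (λ i → c * f i)
∑-distribˡ-* zero    c f = *-zeroʳ c
∑-distribˡ-* (suc n) c f = trans (*-distribˡ-+ c (∑ n f) (f n)) (cong (_+ c * f n) (∑-distribˡ-* n c f))

∑-comm : ∀ n m (f : ℕ → ℕ → ℚ) → ∑ n (λ i → ∑ m (f i)) ≡ ∑ m (λ j → ∑ n (λ i → f i j))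
∑-comm zero    m f = sym (∑-zero m)
∑-comm (suc n) m f =
  trans (cong (_+ ∑ m (f n)) (∑-comm n m f)) (sym (∑-distrib-+ m (λ j → ∑ n (λ i → f i j)) (f n)))

∑-suc : ∀ n (f : ℕ → ℚ) → ∑ (suc n) f ≡ f 0 + ∑ n (f ∘ suc)
∑-suc zero    f = trans (+-identityˡ (f 0)) (sym (+-identityʳ (f 0)))
∑-suc (suc n) f = trans (cong (_+ f (suc n)) (∑-suc n f)) (+-assoc (f 0) _ _)

∑-reverse : ∀ n (f : ℕ → ℚ) → ∑ n f ≡ ∑ n (λ i → f (n ∸ suc i))
∑-reverse zero    f = refl
∑-reverse (suc n) f = sym (begin
  ∑ (suc n) (λ i → f (n ∸ i))       ≡⟨ ∑-suc n (λ i → f (n ∸ i)) ⟩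
  f n + ∑ n (λ i → f (n ∸ suc i))   ≡⟨ cong (λ s → f n + s) (∑-reverse n f) ⟨
  f n + ∑ n f                       ≡⟨ +-comm (f n) (∑ n f) ⟩
  ∑ n f + f n                       ∎)
  where open ≡-Reasoning

∑-telescope : ∀ n (f : ℕ → ℚ) → ∑ n (λ i → f i - f (suc i)) ≡ f 0 - f n
∑-telescope zero    f = sym (+-inverseʳ (f 0))
∑-telescope (suc n) f =
  trans (cong (_+ (f n - f (suc n))) (∑-telescope n f)) (collapse (f 0) (f n) (f (suc n)))
  where
  collapse : ∀ a b c → (a - b) + (b - c) ≡ a - c
  collapse = solve-∀ ℚ-ring

∑-triangle : ∀ N (g : ℕ → ℕ → ℚ) →
  ∑ N (λ m → ∑ m (g m)) ≡ ∑ N (λ n → ∑ (N ∸ suc n) (λ d → g (suc (n ℕ.+ d)) n))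
∑-triangle zero    g = refl
∑-triangle (suc N) g = begin
  ∑ N (λ m → ∑ m (g m)) + ∑ N (g N)                 ≡⟨ cong (_+ ∑ N (g N)) (∑-triangle N g) ⟩
  ∑ N (λ n → ∑ (N ∸ suc n) (column n)) + ∑ N (g N)  ≡⟨ ∑-distrib-+ N _ (g N) ⟨
  ∑ N (λ n → ∑ (N ∸ suc n) (column n) + g N n)      ≡⟨ ∑-cong-< N extend ⟩
  rows                                              ≡⟨ +-identityʳ rows ⟨
  rows + 0ℚ                                         ≡⟨ cong (λ k → rows + ∑ k (column N)) (ℕP.n∸n≡0 N) ⟨
  ∑ (suc N) (λ n → ∑ (N ∸ n) (column n))            ∎
  where
  open ≡-Reasoning
  column : ℕ → ℕ → ℚ
  column n d = g (suc (n ℕ.+ d)) n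
  rows : ℚ
  rows = ∑ N (λ n → ∑ (N ∸ n) (column n))
  extend : ∀ n → n ℕ.< N → ∑ (N ∸ suc n) (column n) + g N n ≡ ∑ (N ∸ n) (column n)
  extend n n<N = trans (cong (λ m → ∑ (N ∸ suc n) (column n) + g m n) (sym (ℕP.m+[n∸m]≡n n<N)))
                       (cong (λ k → ∑ k (column n)) (sym (ℕP.+-∸-assoc 1 n<N)))

∑-mono-≤ : ∀ n {f g : ℕ → ℚ} → (∀ i → i ℕ.< n → f i ≤ℚ g i) → ∑ n f ≤ℚ ∑ n g
∑-mono-≤ zero    f≤g = ≤-refl
∑-mono-≤ (suc n) f≤g =
  +-mono-≤ (∑-mono-≤ n (λ i i<n → f≤g i (ℕP.m<n⇒m<1+n i<n))) (f≤g n ℕP.≤-refl)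

∣∑∣≤∑∣∣ : ∀ n (f : ℕ → ℚ) → ∣ ∑ n f ∣ ≤ℚ ∑ n (λ i → ∣ f i ∣)
∣∑∣≤∑∣∣ zero    f = ≤-refl
∣∑∣≤∑∣∣ (suc n) f =
  ≤-trans (∣p+q∣≤∣p∣+∣q∣ (∑ n f) (f n)) (+-monoˡ-≤ ∣ f n ∣ (∣∑∣≤∑∣∣ n f))

sumFrom≡∑ : ∀ lo n f → sumFrom lo n f ≡ ∑ n (λ i → f (lo ℕ.+ i))
sumFrom≡∑ lo zero    f = refl
sumFrom≡∑ lo (suc n) f = cong (_+ f (lo ℕ.+ n)) (sumFrom≡∑ lo n f)

sumFrom-suc : ∀ lo n f → sumFrom lo (suc n) f ≡ f lo + sumFrom (suc lo) n f
sumFrom-suc lo n f = begin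
  sumFrom lo (suc n) f                        ≡⟨ sumFrom≡∑ lo (suc n) f ⟩
  ∑ (suc n) (λ i → f (lo ℕ.+ i))              ≡⟨ ∑-suc n (λ i → f (lo ℕ.+ i)) ⟩
  f (lo ℕ.+ 0) + ∑ n (λ i → f (lo ℕ.+ suc i)) ≡⟨ cong₂ _+_ (cong f (ℕP.+-identityʳ lo))
                                                           (∑-cong n (λ i → cong f (ℕP.+-suc lo i))) ⟩
  f lo + ∑ n (λ i → f (suc lo ℕ.+ i))         ≡⟨ cong (λ s → f lo + s) (sumFrom≡∑ (suc lo) n f) ⟨
  f lo + sumFrom (suc lo) n f                 ∎
  where open ≡-Reasoning

Z1≡∑ : ∀ k a N → Z1 k a N ≡ ∑ N (term k a)
Z1≡∑ k a zero    = refl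
Z1≡∑ k a (suc N) = cong (_+ term k a N) (Z1≡∑ k a N)

Z2≡∑ : ∀ k₁ a₁ k₂ a₂ N → Z2 k₁ a₁ k₂ a₂ N ≡ ∑ N (λ m → term k₁ a₁ m * Z1 k₂ a₂ m)
Z2≡∑ k₁ a₁ k₂ a₂ zero    = refl
Z2≡∑ k₁ a₁ k₂ a₂ (suc N) = cong (_+ term k₁ a₁ N * Z1 k₂ a₂ N) (Z2≡∑ k₁ a₁ k₂ a₂ N)

-- Geometric sums and partial fractions

geometric-telescope : ∀ K D X Y → D * X * Y ≡ Y - X →
  D * ∑ K (λ i → X ^ suc i * Y ^ (K ∸ i)) ≡ Y ^ K - X ^ K
geometric-telescope K D X Y DXY≡Y-X = begin
  D * ∑ K (λ i → X ^ suc i * Y ^ (K ∸ i))      ≡⟨ ∑-distribˡ-* K D _ ⟩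
  ∑ K (λ i → D * (X ^ suc i * Y ^ (K ∸ i)))    ≡⟨ ∑-cong-< K step ⟩
  ∑ K (λ i → f i - f (suc i))                  ≡⟨ ∑-telescope K f ⟩
  f 0 - f K                                    ≡⟨ cong₂ _-_ (*-identityˡ (Y ^ K)) fK≡X^K ⟩
  Y ^ K - X ^ K                                ∎
  where
  open ≡-Reasoning
  f : ℕ → ℚ
  f i = X ^ i * Y ^ (K ∸ i)
  fK≡X^K : f K ≡ X ^ K
  fK≡X^K = trans (cong (λ j → X ^ K * Y ^ j) (ℕP.n∸n≡0 K)) (*-identityʳ (X ^ K))
  regroup : ∀ D X Y P Q → D * (X * P * (Y * Q)) ≡ D * X * Y * (P * Q)
  regroup = solve-∀ ℚ-ring
  expand : ∀ X Y P Q → (Y - X) * (P * Q) ≡ P * (Y * Q) - X * P * Q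
  expand = solve-∀ ℚ-ring
  peel : ∀ P Q → D * (X * P * (Y * Q)) ≡ P * (Y * Q) - X * P * Q
  peel P Q = trans (regroup D X Y P Q) (trans (cong (_* (P * Q)) DXY≡Y-X) (expand X Y P Q))
  step : ∀ i → i ℕ.< K → D * (X ^ suc i * Y ^ (K ∸ i)) ≡ f i - f (suc i)
  step i i<K = subst (λ j → D * (X ^ suc i * Y ^ j) ≡ X ^ i * Y ^ j - X ^ suc i * Y ^ (K ∸ suc i))
                     (sym (ℕP.+-∸-assoc 1 i<K)) (peel (X ^ i) (Y ^ (K ∸ suc i)))

geometric-partialFraction : ∀ K {m n} → n ℕ.< m →
  ∑ K (λ i → 1/[1+ m ] ^ suc i * 1/[1+ n ] ^ (K ∸ i))
  ≡ 1/[1+ m ∸ suc n ] * (1/[1+ n ] ^ K - 1/[1+ m ] ^ K)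
geometric-partialFraction K {m} {n} n<m = begin
  G                           ≡⟨ *-identityˡ G ⟨
  1ℚ * G                      ≡⟨ cong (_* G) (trans (*-comm 1/[1+ d ] D) (fromℕ*1/[1+n]≡1 d)) ⟨
  1/[1+ d ] * D * G           ≡⟨ *-assoc 1/[1+ d ] D G ⟩
  1/[1+ d ] * (D * G)         ≡⟨ cong (1/[1+ d ] *_) (geometric-telescope K D X Y DXY≡Y-X) ⟩
  1/[1+ d ] * (Y ^ K - X ^ K) ∎
  where
  open ≡-Reasoning
  d : ℕ
  d = m ∸ suc n
  D X Y G : ℚ
  D = fromℕ (suc d)
  X = 1/[1+ m ]
  Y = 1/[1+ n ]
  G = ∑ K (λ i → X ^ suc i * Y ^ (K ∸ i))
  DXY≡Y-X : D * X * Y ≡ Y - X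
  DXY≡Y-X = subst (λ k → D * 1/[1+ k ] * Y ≡ Y - 1/[1+ k ]) (ℕP.m+[n∸m]≡n n<m)
                  (1/[1+]-difference n d)

term-convolution : ∀ a b K {m n} → n ℕ.< m →
  ∑ K (λ i → term (suc i) a m * term (K ∸ i) b n)
  ≡ (sgn a (suc m) * sgn b (suc n)) * (1/[1+ m ∸ suc n ] * (1/[1+ n ] ^ K - 1/[1+ m ] ^ K))
term-convolution a b K {m} {n} n<m = begin
  ∑ K (λ i → term (suc i) a m * term (K ∸ i) b n)
    ≡⟨ ∑-cong K (λ i → cong₂ _*_ (term-≡ (suc i) a m) (term-≡ (K ∸ i) b n)) ⟩
  ∑ K (λ i → (σ * X ^ suc i) * (τ * Y ^ (K ∸ i)))
    ≡⟨ ∑-cong K (λ i → interchange σ τ (X ^ suc i) (Y ^ (K ∸ i))) ⟩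
  ∑ K (λ i → (σ * τ) * (X ^ suc i * Y ^ (K ∸ i)))
    ≡⟨ ∑-distribˡ-* K (σ * τ) _ ⟨
  (σ * τ) * ∑ K (λ i → X ^ suc i * Y ^ (K ∸ i))
    ≡⟨ cong ((σ * τ) *_) (geometric-partialFraction K n<m) ⟩
  (σ * τ) * (1/[1+ m ∸ suc n ] * (Y ^ K - X ^ K)) ∎
  where
  open ≡-Reasoning
  σ τ X Y : ℚ
  σ = sgn a (suc m)
  τ = sgn b (suc n)
  X = 1/[1+ m ]
  Y = 1/[1+ n ]
  interchange : ∀ a b c d → (a * c) * (b * d) ≡ (a * b) * (c * d)
  interchange = solve-∀ ℚ-ring

-- Error estimates

∣p-q∣≡∣q-p∣ : ∀ p q → ∣ p - q ∣ ≡ ∣ q - p ∣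
∣p-q∣≡∣q-p∣ p q = trans (cong ∣_∣ (negate p q)) (∣-p∣≡∣p∣ (q - p))
  where
  negate : ∀ p q → p - q ≡ - (q - p)
  negate = solve-∀ ℚ-ring

Z1₁-increment : ∀ a r c → ∣ Z1 1 a (r ℕ.+ c) - Z1 1 a r ∣ ≤ℚ fromℕ c * 1/[1+ r ]
Z1₁-increment a r zero = ≤-reflexive (begin
  ∣ Z1 1 a (r ℕ.+ 0) - Z1 1 a r ∣  ≡⟨ cong (λ m → ∣ Z1 1 a m - Z1 1 a r ∣) (ℕP.+-identityʳ r) ⟩
  ∣ Z1 1 a r - Z1 1 a r ∣          ≡⟨ cong ∣_∣ (+-inverseʳ (Z1 1 a r)) ⟩
  0ℚ                               ≡⟨ *-zeroˡ 1/[1+ r ] ⟨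
  fromℕ 0 * 1/[1+ r ]              ∎)
  where open ≡-Reasoning
Z1₁-increment a r (suc c) = begin
  ∣ Z1 1 a (r ℕ.+ suc c) - Z1 1 a r ∣             ≡⟨ cong (λ m → ∣ Z1 1 a m - Z1 1 a r ∣) (ℕP.+-suc r c) ⟩
  ∣ (Z1 1 a (r ℕ.+ c) + τ) - Z1 1 a r ∣            ≡⟨ cong ∣_∣ (rearrange (Z1 1 a (r ℕ.+ c)) τ (Z1 1 a r)) ⟩
  ∣ (Z1 1 a (r ℕ.+ c) - Z1 1 a r) + τ ∣            ≤⟨ ∣p+q∣≤∣p∣+∣q∣ (Z1 1 a (r ℕ.+ c) - Z1 1 a r) τ ⟩
  ∣ Z1 1 a (r ℕ.+ c) - Z1 1 a r ∣ + ∣ τ ∣          ≤⟨ +-mono-≤ (Z1₁-increment a r c) ∣τ∣≤1/[1+r] ⟩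
  fromℕ c * 1/[1+ r ] + 1/[1+ r ]                  ≡⟨ collect (fromℕ c) 1/[1+ r ] ⟩
  (1ℚ + fromℕ c) * 1/[1+ r ]                       ≡⟨ cong (_* 1/[1+ r ]) (fromℕ-suc c) ⟨
  fromℕ (suc c) * 1/[1+ r ]                        ∎
  where
  open ≤-Reasoning
  τ : ℚ
  τ = term 1 a (r ℕ.+ c)
  rearrange : ∀ p τ q → (p + τ) - q ≡ (p - q) + τ
  rearrange = solve-∀ ℚ-ring
  collect : ∀ x y → x * y + y ≡ (1ℚ + x) * y
  collect = solve-∀ ℚ-ring
  ∣τ∣≤1/[1+r] : ∣ τ ∣ ≤ℚ 1/[1+ r ]
  ∣τ∣≤1/[1+r] = ≤-trans (≤-reflexive (trans (∣term∣ 1 a (r ℕ.+ c)) (*-identityʳ _)))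
                        (1/[1+]-antitone (ℕP.m≤m+n r c))

harmonic : ℕ → ℚ
harmonic N = ∑ N 1/[1+_]

harmonic≤fromℕ : ∀ N → harmonic N ≤ℚ fromℕ N
harmonic≤fromℕ zero    = ≤-refl
harmonic≤fromℕ (suc N) = ≤-trans (+-mono-≤ (harmonic≤fromℕ N) (1/[1+]≤1 N))
                                 (≤-reflexive (trans (+-comm (fromℕ N) 1ℚ) (sym (fromℕ-suc N))))

-- The first b + 1 terms are at most 1 and the others at most 1/(b+1).
harmonic-split-bound : ∀ b N → harmonic N ≤ℚ fromℕ (suc b) + fromℕ N * 1/[1+ b ]
harmonic-split-bound b zero = ≤-trans (fromℕ-nonNeg (suc b))
  (≤-reflexive (sym (trans (cong (λ x → fromℕ (suc b) + x) (*-zeroˡ 1/[1+ b ])) (+-identityʳ _))))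
harmonic-split-bound b (suc N) with N ℕ.≤? b
... | yes N≤b = ≤-trans (harmonic≤fromℕ (suc N)) (≤-trans (fromℕ-mono-≤ (s≤s N≤b))
                  (≤-trans (≤-reflexive (sym (+-identityʳ _)))
                           (+-monoʳ-≤ (fromℕ (suc b)) (*-nonNeg (fromℕ-nonNeg (suc N)) (1/[1+]-nonNeg b)))))
... | no  N≰b = ≤-trans (+-mono-≤ (harmonic-split-bound b N) (1/[1+]-antitone (ℕP.<⇒≤ (ℕP.≰⇒> N≰b))))
                  (≤-reflexive (trans (collect (fromℕ (suc b)) (fromℕ N) 1/[1+ b ])
                                      (cong (λ x → fromℕ (suc b) + x * 1/[1+ b ]) (sym (fromℕ-suc N)))))
  where
  collect : ∀ c x y → (c + x * y) + y ≡ c + (1ℚ + x) * y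
  collect = solve-∀ ℚ-ring

*-pos : ∀ {p q} → 0ℚ < p → 0ℚ < q → 0ℚ < p * q
*-pos {p} {q} 0<p 0<q = positive⁻¹ (p * q) {{pos*pos⇒pos p {{positive 0<p}} q {{positive 0<q}}}}

halves : ∀ ε → ½ * ε + ½ * ε ≡ ε
halves ε = trans (double ½ ε) (*-identityˡ ε)
  where
  double : ∀ h ε → h * ε + h * ε ≡ (h + h) * ε
  double = solve-∀ ℚ-ring

1/[1+]*harmonic→0 : ∀ ε → 0ℚ < ε → ∃ λ N₀ → ∀ N → N₀ ≤ N → 1/[1+ N ] * harmonic N < ε
1/[1+]*harmonic→0 ε 0<ε with archimedean (½ * ε) (*-pos (1/[1+]-pos 1) 0<ε)
... | b , 1/[1+b]<ε/2 with archimedean (½ * ε * 1/[1+ b ]) (*-pos (*-pos (1/[1+]-pos 1) 0<ε) (1/[1+]-pos b))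
... | c , 1/[1+c]<ε/2[1+b] = c , bound
  where
  B : ℚ
  B = fromℕ (suc b)
  bound : ∀ N → c ≤ N → 1/[1+ N ] * harmonic N < ε
  bound N c≤N = begin-strict
    1/[1+ N ] * harmonic N
      ≤⟨ *-monoˡ-≤-nonNeg 1/[1+ N ] {{nonNegative (1/[1+]-nonNeg N)}} (harmonic-split-bound b N) ⟩
    1/[1+ N ] * (B + fromℕ N * 1/[1+ b ])
      ≡⟨ expand 1/[1+ N ] B (fromℕ N) 1/[1+ b ] ⟩
    B * 1/[1+ N ] + (fromℕ N * 1/[1+ N ]) * 1/[1+ b ]
      <⟨ +-mono-< first second ⟩
    ½ * ε + ½ * ε
      ≡⟨ halves ε ⟩
    ε ∎
    where
    open ≤-Reasoning
    expand : ∀ u B x v → u * (B + x * v) ≡ B * u + (x * u) * v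
    expand = solve-∀ ℚ-ring
    cancel : ∀ B h v → B * (h * v) ≡ h * (B * v)
    cancel = solve-∀ ℚ-ring
    first : B * 1/[1+ N ] < ½ * ε
    first = begin-strict
      B * 1/[1+ N ]            ≤⟨ *-monoˡ-≤-nonNeg B {{nonNegative (fromℕ-nonNeg (suc b))}} (1/[1+]-antitone c≤N) ⟩
      B * 1/[1+ c ]            <⟨ *-monoʳ-<-pos B {{positive (fromℕ-pos b)}} 1/[1+c]<ε/2[1+b] ⟩
      B * (½ * ε * 1/[1+ b ])  ≡⟨ cancel B (½ * ε) 1/[1+ b ] ⟩
      ½ * ε * (B * 1/[1+ b ])  ≡⟨ cong (½ * ε *_) (fromℕ*1/[1+n]≡1 b) ⟩
      ½ * ε * 1ℚ               ≡⟨ *-identityʳ (½ * ε) ⟩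
      ½ * ε                    ∎
    second : (fromℕ N * 1/[1+ N ]) * 1/[1+ b ] < ½ * ε
    second = begin-strict
      (fromℕ N * 1/[1+ N ]) * 1/[1+ b ]
        ≤⟨ *-monoʳ-≤-nonNeg 1/[1+ b ] {{nonNegative (1/[1+]-nonNeg b)}} (≤-trans
             (*-monoʳ-≤-nonNeg 1/[1+ N ] {{nonNegative (1/[1+]-nonNeg N)}} (fromℕ-mono-≤ (ℕP.n≤1+n N)))
             (≤-reflexive (fromℕ*1/[1+n]≡1 N))) ⟩
      1ℚ * 1/[1+ b ]  ≡⟨ *-identityˡ 1/[1+ b ] ⟩
      1/[1+ b ]       <⟨ 1/[1+b]<ε/2 ⟩
      ½ * ε           ∎

SameLimit-byError : ∀ {s t : ℕ → ℚ} (e : ℕ → ℚ) → (∀ N → s N - t N ≡ e N) →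
  (∀ N → ∣ e N ∣ ≤ℚ 1/[1+ N ] * (harmonic N + harmonic N)) → SameLimit s t
SameLimit-byError {s} {t} e s-t≡e ∣e∣≤ ε 0<ε = N₀ , close
  where
  vanishing : ∃ λ N₀ → ∀ N → N₀ ≤ N → 1/[1+ N ] * harmonic N < ½ * ε
  vanishing = 1/[1+]*harmonic→0 (½ * ε) (*-pos (1/[1+]-pos 1) 0<ε)
  N₀ : ℕ
  N₀ = proj₁ vanishing
  close : ∀ N → N₀ ≤ N → ∣ s N - t N ∣ < ε
  close N N₀≤N = begin-strict
    ∣ s N - t N ∣                               ≡⟨ cong ∣_∣ (s-t≡e N) ⟩
    ∣ e N ∣                                     ≤⟨ ∣e∣≤ N ⟩
    1/[1+ N ] * (harmonic N + harmonic N)       ≡⟨ *-distribˡ-+ 1/[1+ N ] (harmonic N) (harmonic N) ⟩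
    1/[1+ N ] * harmonic N + 1/[1+ N ] * harmonic N
                                                <⟨ +-mono-< (proj₂ vanishing N N₀≤N) (proj₂ vanishing N N₀≤N) ⟩
    ½ * ε + ½ * ε                               ≡⟨ halves ε ⟩
    ε                                           ∎
    where open ≤-Reasoning

SameLimit-resp-difference : ∀ {s t s′ t′ : ℕ → ℚ} → (∀ N → s N - t N ≡ s′ N - t′ N) →
  SameLimit s t → SameLimit s′ t′
SameLimit-resp-difference same-difference s≈t ε 0<ε =
  proj₁ (s≈t ε 0<ε) ,
  λ N N₀≤N → subst (λ x → ∣ x ∣ < ε) (same-difference N) (proj₂ (s≈t ε 0<ε) N N₀≤N)

SameLimit-cong : ∀ {s t s′ t′ : ℕ → ℚ} → (∀ N → s N ≡ s′ N) → (∀ N → t N ≡ t′ N) →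
  SameLimit s t → SameLimit s′ t′
SameLimit-cong {s} {t} {s′} {t′} s≡s′ t≡t′ =
  SameLimit-resp-difference {s} {t} {s′} {t′} (λ N → cong₂ _-_ (s≡s′ N) (t≡t′ N))

SameLimit-congʳ : ∀ {s t t′ : ℕ → ℚ} → (∀ N → t N ≡ t′ N) → SameLimit s t → SameLimit s t′
SameLimit-congʳ {s} {t} {t′} = SameLimit-cong {s} {t} {s} {t′} (λ _ → refl)

SameLimit-cancelˡ : ∀ {a s t : ℕ → ℚ} → SameLimit (λ N → a N + s N) (λ N → a N + t N) → SameLimit s t
SameLimit-cancelˡ {a} {s} {t} =
  SameLimit-resp-difference {λ N → a N + s N} {λ N → a N + t N} {s} {t} (λ N → cancel (a N) (s N) (t N))
  where
  cancel : ∀ a s t → (a + s) - (a + t) ≡ s - t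
  cancel = solve-∀ ℚ-ring

-- The weight sum

weightSum weightSumLimit : Bool → Bool → ℕ → ℕ → ℚ
weightSum a b K N = sumFrom 1 K (λ j → Z2 j a (suc K ∸ j) b N)
weightSumLimit a b K N =
  Z2 1 a K (a xor b) N + Z2 K (a xor b) 1 a N - Z2 K (a xor b) 1 b N + Z1 (suc K) b N

module Decomposition (a b : Bool) (K : ℕ) where

  t : Bool
  t = a xor b

  -- The two halves of the telescoped sum over j, at 0-based indices n < m (the integers n + 1 < m + 1).
  innerPower outerPower : ℕ → ℕ → ℚ
  innerPower m n = (sgn a (suc m) * sgn b (suc n)) * (1/[1+ m ∸ suc n ] * 1/[1+ n ] ^ K)
  outerPower m n = (sgn a (suc m) * sgn b (suc n)) * (1/[1+ m ∸ suc n ] * 1/[1+ m ] ^ K)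

  weightSum≡inner-outer : ∀ N →
    weightSum a b K N ≡ ∑ N (λ m → ∑ m (innerPower m)) - ∑ N (λ m → ∑ m (outerPower m))
  weightSum≡inner-outer N = begin
    weightSum a b K N
      ≡⟨ sumFrom≡∑ 1 K _ ⟩
    ∑ K (λ i → Z2 (suc i) a (K ∸ i) b N)
      ≡⟨ ∑-cong K (λ i → Z2≡∑ (suc i) a (K ∸ i) b N) ⟩
    ∑ K (λ i → ∑ N (λ m → term (suc i) a m * Z1 (K ∸ i) b m))
      ≡⟨ ∑-comm K N _ ⟩
    ∑ N (λ m → ∑ K (λ i → term (suc i) a m * Z1 (K ∸ i) b m))
      ≡⟨ ∑-cong N convolution ⟩
    ∑ N (λ m → ∑ m (innerPower m) - ∑ m (outerPower m))
      ≡⟨ ∑-distrib-- N _ _ ⟩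
    ∑ N (λ m → ∑ m (innerPower m)) - ∑ N (λ m → ∑ m (outerPower m)) ∎
    where
    open ≡-Reasoning
    distribute : ∀ c u Y X → c * (u * (Y - X)) ≡ c * (u * Y) - c * (u * X)
    distribute = solve-∀ ℚ-ring
    convolution : ∀ m →
      ∑ K (λ i → term (suc i) a m * Z1 (K ∸ i) b m) ≡ ∑ m (innerPower m) - ∑ m (outerPower m)
    convolution m = begin
      ∑ K (λ i → term (suc i) a m * Z1 (K ∸ i) b m)
        ≡⟨ ∑-cong K (λ i → trans (cong (term (suc i) a m *_) (Z1≡∑ (K ∸ i) b m))
                                 (∑-distribˡ-* m (term (suc i) a m) (term (K ∸ i) b))) ⟩
      ∑ K (λ i → ∑ m (λ n → term (suc i) a m * term (K ∸ i) b n))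
        ≡⟨ ∑-comm K m _ ⟩
      ∑ m (λ n → ∑ K (λ i → term (suc i) a m * term (K ∸ i) b n))
        ≡⟨ ∑-cong-< m (λ n n<m → trans (term-convolution a b K n<m)
             (distribute (sgn a (suc m) * sgn b (suc n)) 1/[1+ m ∸ suc n ] (1/[1+ n ] ^ K) (1/[1+ m ] ^ K))) ⟩
      ∑ m (λ n → innerPower m n - outerPower m n)
        ≡⟨ ∑-distrib-- m _ _ ⟩
      ∑ m (innerPower m) - ∑ m (outerPower m) ∎

  outerPower-sum : ∀ N → ∑ N (λ m → ∑ m (outerPower m)) ≡ Z2 K t 1 b N
  outerPower-sum N = trans (∑-cong N row) (sym (Z2≡∑ K t 1 b N))
    where
    open ≡-Reasoning
    regroup : ∀ σ ρ ι Y P → (σ * (ρ * ι)) * (Y * P) ≡ ((σ * ρ) * P) * (ι * (Y * 1ℚ))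
    regroup = solve-∀ ℚ-ring
    reflected : ∀ m i → i ℕ.< m → outerPower m (m ∸ suc i) ≡ term K t m * term 1 b i
    reflected m i i<m = begin
      outerPower m (m ∸ suc i)
        ≡⟨ cong₂ (λ j l → (sgn a (suc m) * sgn b j) * (1/[1+ l ] * 1/[1+ m ] ^ K))
                 (sym (ℕP.+-∸-assoc 1 i<m))
                 (trans (cong (m ∸_) (sym (ℕP.+-∸-assoc 1 i<m))) (ℕP.m∸[m∸n]≡n (ℕP.<⇒≤ i<m))) ⟩
      (sgn a (suc m) * sgn b (suc m ∸ suc i)) * (1/[1+ i ] * 1/[1+ m ] ^ K)
        ≡⟨ cong (λ s → (sgn a (suc m) * s) * (1/[1+ i ] * 1/[1+ m ] ^ K)) (sgn-∸ b (s≤s (ℕP.<⇒≤ i<m))) ⟩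
      (sgn a (suc m) * (sgn b (suc m) * sgn b (suc i))) * (1/[1+ i ] * 1/[1+ m ] ^ K)
        ≡⟨ regroup (sgn a (suc m)) (sgn b (suc m)) (sgn b (suc i)) 1/[1+ i ] (1/[1+ m ] ^ K) ⟩
      ((sgn a (suc m) * sgn b (suc m)) * 1/[1+ m ] ^ K) * (sgn b (suc i) * 1/[1+ i ] ^ 1)
        ≡⟨ cong₂ _*_ (term-xor K a b m) (term-≡ 1 b i) ⟨
      term K t m * term 1 b i ∎
    row : ∀ m → ∑ m (outerPower m) ≡ term K t m * Z1 1 b m
    row m = begin
      ∑ m (outerPower m)                          ≡⟨ ∑-reverse m (outerPower m) ⟩
      ∑ m (λ i → outerPower m (m ∸ suc i))        ≡⟨ ∑-cong-< m (reflected m) ⟩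
      ∑ m (λ i → term K t m * term 1 b i)         ≡⟨ ∑-distribˡ-* m (term K t m) (term 1 b) ⟨
      term K t m * ∑ m (term 1 b)                 ≡⟨ cong (term K t m *_) (Z1≡∑ 1 b m) ⟨
      term K t m * Z1 1 b m                       ∎

  innerPower-sum : ∀ N → ∑ N (λ m → ∑ m (innerPower m)) ≡ ∑ N (λ n → term K t n * Z1 1 a (N ∸ suc n))
  innerPower-sum N = trans (∑-triangle N innerPower) (∑-cong N column)
    where
    open ≡-Reasoning
    regroup : ∀ σ ι τ U P → ((σ * ι) * τ) * (U * P) ≡ ((σ * τ) * P) * (ι * (U * 1ℚ))
    regroup = solve-∀ ℚ-ring
    shifted : ∀ n d → innerPower (suc (n ℕ.+ d)) n ≡ term K t n * term 1 a d
    shifted n d = begin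
      innerPower (suc (n ℕ.+ d)) n
        ≡⟨ cong₂ (λ j l → (sgn a j * sgn b (suc n)) * (1/[1+ l ] * 1/[1+ n ] ^ K))
                 (cong suc (sym (ℕP.+-suc n d))) (ℕP.m+n∸m≡n n d) ⟩
      (sgn a (suc n ℕ.+ suc d) * sgn b (suc n)) * (1/[1+ d ] * 1/[1+ n ] ^ K)
        ≡⟨ cong (λ s → (s * sgn b (suc n)) * (1/[1+ d ] * 1/[1+ n ] ^ K)) (sgn-+ a (suc n) (suc d)) ⟩
      ((sgn a (suc n) * sgn a (suc d)) * sgn b (suc n)) * (1/[1+ d ] * 1/[1+ n ] ^ K)
        ≡⟨ regroup (sgn a (suc n)) (sgn a (suc d)) (sgn b (suc n)) 1/[1+ d ] (1/[1+ n ] ^ K) ⟩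
      ((sgn a (suc n) * sgn b (suc n)) * 1/[1+ n ] ^ K) * (sgn a (suc d) * 1/[1+ d ] ^ 1)
        ≡⟨ cong₂ _*_ (term-xor K a b n) (term-≡ 1 a d) ⟨
      term K t n * term 1 a d ∎
    column : ∀ n → ∑ (N ∸ suc n) (λ d → innerPower (suc (n ℕ.+ d)) n) ≡ term K t n * Z1 1 a (N ∸ suc n)
    column n = begin
      ∑ (N ∸ suc n) (λ d → innerPower (suc (n ℕ.+ d)) n) ≡⟨ ∑-cong (N ∸ suc n) (shifted n) ⟩
      ∑ (N ∸ suc n) (λ d → term K t n * term 1 a d)     ≡⟨ ∑-distribˡ-* (N ∸ suc n) (term K t n) (term 1 a) ⟨
      term K t n * ∑ (N ∸ suc n) (term 1 a)             ≡⟨ cong (term K t n *_) (Z1≡∑ 1 a (N ∸ suc n)) ⟨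
      term K t n * Z1 1 a (N ∸ suc n)                   ∎

  error : ℕ → ℚ
  error N = ∑ N (λ n → term K t n * (Z1 1 a (N ∸ suc n) - Z1 1 a N))

  Z2₁-by-inner-index : ∀ N → Z2 1 a K t N ≡ ∑ N (λ n → term K t n * (Z1 1 a N - Z1 1 a (suc n)))
  Z2₁-by-inner-index zero    = refl
  Z2₁-by-inner-index (suc N) = sym (begin
    ∑ N (λ n → term K t n * ((h N + α) - h (suc n))) + term K t N * (h (suc N) - h (suc N))
      ≡⟨ cong₂ _+_ (∑-cong N (λ n → split (term K t n) (h N) α (h (suc n))))
                   (vanish (term K t N) (h (suc N))) ⟩
    ∑ N (λ n → term K t n * (h N - h (suc n)) + α * term K t n) + 0ℚ
      ≡⟨ +-identityʳ _ ⟩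
    ∑ N (λ n → term K t n * (h N - h (suc n)) + α * term K t n)
      ≡⟨ ∑-distrib-+ N _ _ ⟩
    ∑ N (λ n → term K t n * (h N - h (suc n))) + ∑ N (λ n → α * term K t n)
      ≡⟨ cong₂ _+_ (Z2₁-by-inner-index N) (∑-distribˡ-* N α (term K t)) ⟨
    Z2 1 a K t N + α * ∑ N (term K t)
      ≡⟨ cong (λ s → Z2 1 a K t N + α * s) (Z1≡∑ K t N) ⟨
    Z2 1 a K t N + α * Z1 K t N ∎)
    where
    open ≡-Reasoning
    h : ℕ → ℚ
    h = Z1 1 a
    α : ℚ
    α = term 1 a N
    split : ∀ x z α w → x * ((z + α) - w) ≡ x * (z - w) + α * x
    split = solve-∀ ℚ-ring
    vanish : ∀ x y → x * (y - y) ≡ 0ℚ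
    vanish = solve-∀ ℚ-ring

  Z2-with-diagonal : ∀ N → ∑ N (λ n → term K t n * Z1 1 a (suc n)) ≡ Z2 K t 1 a N + Z1 (suc K) b N
  Z2-with-diagonal N = begin
    ∑ N (λ n → term K t n * Z1 1 a (suc n))
      ≡⟨ ∑-cong N (λ n → *-distribˡ-+ (term K t n) (Z1 1 a n) (term 1 a n)) ⟩
    ∑ N (λ n → term K t n * Z1 1 a n + term K t n * term 1 a n)
      ≡⟨ ∑-distrib-+ N _ _ ⟩
    ∑ N (λ n → term K t n * Z1 1 a n) + ∑ N (λ n → term K t n * term 1 a n)
      ≡⟨ cong₂ _+_ (Z2≡∑ K t 1 a N) (∑-cong N (λ n → sym (term-xor*term₁ K a b n))) ⟨
    Z2 K t 1 a N + ∑ N (term (suc K) b)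
      ≡⟨ cong (λ s → Z2 K t 1 a N + s) (Z1≡∑ (suc K) b N) ⟨
    Z2 K t 1 a N + Z1 (suc K) b N ∎
    where open ≡-Reasoning

  weightSum-decomposition : ∀ N →
    weightSum a b K N ≡ error N + Z2 1 a K t N + Z2 K t 1 a N - Z2 K t 1 b N + Z1 (suc K) b N
  weightSum-decomposition N = begin
    weightSum a b K N
      ≡⟨ weightSum≡inner-outer N ⟩
    ∑ N (λ m → ∑ m (innerPower m)) - ∑ N (λ m → ∑ m (outerPower m))
      ≡⟨ cong₂ _-_ (innerPower-sum N) (outerPower-sum N) ⟩
    ∑ N (λ n → x n * h (N ∸ suc n)) - Z2 K t 1 b N
      ≡⟨ cong (_- Z2 K t 1 b N) (∑-cong N (λ n → three-ways (x n) (h (N ∸ suc n)) (h N) (h (suc n)))) ⟩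
    ∑ N (λ n → x n * (h (N ∸ suc n) - h N) + (x n * (h N - h (suc n)) + x n * h (suc n))) - Z2 K t 1 b N
      ≡⟨ cong (_- Z2 K t 1 b N) (trans (∑-distrib-+ N _ _) (cong (λ s → error N + s) (∑-distrib-+ N _ _))) ⟩
    error N + (∑ N (λ n → x n * (h N - h (suc n))) + ∑ N (λ n → x n * h (suc n))) - Z2 K t 1 b N
      ≡⟨ cong₂ (λ p q → error N + (p + q) - Z2 K t 1 b N) (sym (Z2₁-by-inner-index N)) (Z2-with-diagonal N) ⟩
    error N + (Z2 1 a K t N + (Z2 K t 1 a N + Z1 (suc K) b N)) - Z2 K t 1 b N
      ≡⟨ reassociate (error N) (Z2 1 a K t N) (Z2 K t 1 a N) (Z1 (suc K) b N) (Z2 K t 1 b N) ⟩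
    error N + Z2 1 a K t N + Z2 K t 1 a N - Z2 K t 1 b N + Z1 (suc K) b N ∎
    where
    open ≡-Reasoning
    x : ℕ → ℚ
    x = term K t
    h : ℕ → ℚ
    h = Z1 1 a
    three-ways : ∀ x A B C → x * A ≡ x * (A - B) + (x * (B - C) + x * C)
    three-ways = solve-∀ ℚ-ring
    reassociate : ∀ e p q r s → e + (p + (q + r)) - s ≡ e + p + q - s + r
    reassociate = solve-∀ ℚ-ring

  error-term-bound : 2 ≤ K → ∀ {N n} → n ℕ.< N →
    ∣ term K t n * (Z1 1 a (N ∸ suc n) - Z1 1 a N) ∣ ≤ℚ 1/[1+ N ] * (1/[1+ n ] + 1/[1+ N ∸ suc n ])
  error-term-bound 2≤K {N} {n} n<N = begin
    ∣ term K t n * (Z1 1 a r - Z1 1 a N) ∣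
      ≡⟨ trans (∣p*q∣≡∣p∣*∣q∣ (term K t n) _)
               (cong₂ _*_ (∣term∣ K t n) (∣p-q∣≡∣q-p∣ (Z1 1 a r) (Z1 1 a N))) ⟩
    Y ^ K * ∣ Z1 1 a N - Z1 1 a r ∣
      ≡⟨ cong (λ m → Y ^ K * ∣ Z1 1 a m - Z1 1 a r ∣) r+[1+n]≡N ⟨
    Y ^ K * ∣ Z1 1 a (r ℕ.+ suc n) - Z1 1 a r ∣
      ≤⟨ *-mono-≤-nonNeg (^-nonNeg K (1/[1+]-nonNeg n)) (0≤∣p∣ _)
           (^-antitone (1/[1+]-nonNeg n) (1/[1+]≤1 n) 2≤K) (Z1₁-increment a r (suc n)) ⟩
    Y ^ 2 * (fromℕ (suc n) * 1/[1+ r ])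
      ≡⟨ regroup Y (fromℕ (suc n)) 1/[1+ r ] ⟩
    (fromℕ (suc n) * Y) * (Y * 1/[1+ r ])
      ≡⟨ trans (cong (_* (Y * 1/[1+ r ])) (fromℕ*1/[1+n]≡1 n)) (*-identityˡ _) ⟩
    Y * 1/[1+ r ]
      ≡⟨ 1/[1+]-product n r ⟩
    1/[1+ suc (n ℕ.+ r) ] * (Y + 1/[1+ r ])
      ≡⟨ cong (λ m → 1/[1+ m ] * (Y + 1/[1+ r ])) (ℕP.m+[n∸m]≡n n<N) ⟩
    1/[1+ N ] * (Y + 1/[1+ r ]) ∎
    where
    open ≤-Reasoning
    r : ℕ
    r = N ∸ suc n
    Y : ℚ
    Y = 1/[1+ n ]
    r+[1+n]≡N : r ℕ.+ suc n ≡ N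
    r+[1+n]≡N = trans (ℕP.+-comm r (suc n)) (ℕP.m+[n∸m]≡n n<N)
    regroup : ∀ Y I R → Y * (Y * 1ℚ) * (I * R) ≡ (I * Y) * (Y * R)
    regroup = solve-∀ ℚ-ring

  error-bound : 2 ≤ K → ∀ N → ∣ error N ∣ ≤ℚ 1/[1+ N ] * (harmonic N + harmonic N)
  error-bound 2≤K N = begin
    ∣ error N ∣
      ≤⟨ ∣∑∣≤∑∣∣ N _ ⟩
    ∑ N (λ n → ∣ term K t n * (Z1 1 a (N ∸ suc n) - Z1 1 a N) ∣)
      ≤⟨ ∑-mono-≤ N (λ n n<N → error-term-bound 2≤K n<N) ⟩
    ∑ N (λ n → 1/[1+ N ] * (1/[1+ n ] + 1/[1+ N ∸ suc n ]))
      ≡⟨ ∑-distribˡ-* N 1/[1+ N ] _ ⟨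
    1/[1+ N ] * ∑ N (λ n → 1/[1+ n ] + 1/[1+ N ∸ suc n ])
      ≡⟨ cong (1/[1+ N ] *_) (trans (∑-distrib-+ N 1/[1+_] (λ n → 1/[1+ N ∸ suc n ]))
                                    (cong (λ s → harmonic N + s) (sym (∑-reverse N 1/[1+_])))) ⟩
    1/[1+ N ] * (harmonic N + harmonic N) ∎
    where open ≤-Reasoning

Z2-weight-sum-limit : ∀ a b K → 2 ≤ K → SameLimit (weightSum a b K) (weightSumLimit a b K)
Z2-weight-sum-limit a b K 2≤K =
  SameLimit-byError {weightSum a b K} {weightSumLimit a b K} error difference (error-bound 2≤K)
  where
  open Decomposition a b K
  cancel : ∀ e p q r s → (e + p + q - r + s) - (p + q - r + s) ≡ e
  cancel = solve-∀ ℚ-ring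
  difference : ∀ N → weightSum a b K N - weightSumLimit a b K N ≡ error N
  difference N = trans (cong (_- weightSumLimit a b K N) (weightSum-decomposition N))
    (cancel (error N) (Z2 1 a K t N) (Z2 K t 1 a N) (Z2 K t 1 b N) (Z1 (suc K) b N))

weightSumLimit-same : ∀ a K N → weightSumLimit a a K N ≡ Z2 1 a K (a xor a) N + Z1 (suc K) a N
weightSumLimit-same a K N = x+y-y+z≡x+z (Z2 1 a K (a xor a) N) (Z2 K (a xor a) 1 a N) (Z1 (suc K) a N)
  where
  x+y-y+z≡x+z : ∀ x y z → x + y - y + z ≡ x + z
  x+y-y+z≡x+z = solve-∀ ℚ-ring

weightSumLimit-assoc : ∀ a b K N → weightSumLimit a b K N
  ≡ Z2 1 a K (a xor b) N + (Z2 K (a xor b) 1 a N - Z2 K (a xor b) 1 b N + Z1 (suc K) b N)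
weightSumLimit-assoc a b K N = x+y-z+w≡x+[y-z+w]
  (Z2 1 a K (a xor b) N) (Z2 K (a xor b) 1 a N) (Z2 K (a xor b) 1 b N) (Z1 (suc K) b N)
  where
  x+y-z+w≡x+[y-z+w] : ∀ x y z w → x + y - z + w ≡ x + (y - z + w)
  x+y-z+w≡x+[y-z+w] = solve-∀ ℚ-ring

weightSumLimit-rotate : ∀ a b K N → weightSumLimit a b K N
  ≡ Z2 K (a xor b) 1 a N - Z2 K (a xor b) 1 b N + Z2 1 a K (a xor b) N + Z1 (suc K) b N
weightSumLimit-rotate a b K N = x+y-z+w≡y-z+x+w
  (Z2 1 a K (a xor b) N) (Z2 K (a xor b) 1 a N) (Z2 K (a xor b) 1 b N) (Z1 (suc K) b N)
  where
  x+y-z+w≡y-z+x+w : ∀ x y z w → x + y - z + w ≡ y - z + x + w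
  x+y-z+w≡y-z+x+w = solve-∀ ℚ-ring

corollary4p7 : (k : ℕ) → 3 ≤ k →
    SameLimit (λ N → sumFrom 2 (k ∸ 2) (λ j → Z2 j false (k ∸ j) false N))
              (λ N → Z1 k false N)
    × SameLimit (λ N → sumFrom 2 (k ∸ 2) (λ j → Z2 j false (k ∸ j) true N))
                (λ N → Z2 (k ∸ 1) true 1 false N - Z2 (k ∸ 1) true 1 true N + Z1 k true N)
    × SameLimit (λ N → sumFrom 1 (k ∸ 1) (λ j → Z2 j true (k ∸ j) true N))
                (λ N → Z2 1 true (k ∸ 1) false N + Z1 k true N)
    × SameLimit (λ N → sumFrom 1 (k ∸ 1) (λ j → Z2 j true (k ∸ j) false N))
                (λ N → Z2 (k ∸ 1) true 1 true N - Z2 (k ∸ 1) true 1 false N + Z2 1 true (k ∸ 1) true N + Z1 k false N)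
corollary4p7 (suc (suc (suc K'))) (s≤s (s≤s (s≤s _))) =
    SameLimit-cancelˡ {Z2 1 false K false}
      (SameLimit-cong (split-first false) (weightSumLimit-same false K) (limit false false))
  , SameLimit-cancelˡ {Z2 1 false K true}
      (SameLimit-cong (split-first true) (weightSumLimit-assoc false true K) (limit false true))
  , SameLimit-congʳ {weightSum true true K} (weightSumLimit-same true K) (limit true true)
  , SameLimit-congʳ {weightSum true false K} (weightSumLimit-rotate true false K) (limit true false)
  where
  K : ℕ
  K = suc (suc K')
  limit : ∀ a b → SameLimit (weightSum a b K) (weightSumLimit a b K)
  limit a b = Z2-weight-sum-limit a b K (s≤s (s≤s z≤n))
  split-first : ∀ b N →
    weightSum false b K N ≡ Z2 1 false K b N + sumFrom 2 (suc K') (λ j → Z2 j false (suc K ∸ j) b N)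
  split-first b N = sumFrom-suc 1 (suc K') (λ j → Z2 j false (suc K ∸ j) b N)
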